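{- Let $a,b_1,b_2$ be elements of a finite co-Heyting algebra $L$ with $b_1\vee b_2\ll a$ and $a\ne\mathbf 0$. Then there exist a finite co-Heyting algebra $L'$ containing $L$ as a subalgebra and non-zero elements $a_1,a_2\in L'$ such that $a-a_2=a_1\ge b_1$, $a-a_1=a_2\ge b_2$, and $a_1\wedge a_2=b_1\wedge b_2$.
   Context: A co-Heyting algebra is a bounded distributive lattice $(L,\mathbf{0},\mathbf{1},\vee,\wedge)$ with a binary operation $-$ such that $a-b$ is the least $c\in L$ with $a\le b\vee c$; subalgebras are in the language $\{\mathbf 0,\mathbf 1,\vee,\wedge,-\}$. For $a,b$ write $b\ll a$ iff $a-b=a$ and $b\le a$. -}

module Defs where

open import Level using (Level; _⊔_) renaming (suc to lsuc)
open import Relation.Binary.Core using (Rel)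
open import Algebra.Core using (Op₂)
open import Algebra.Definitions using (Congruent₂)
open import Algebra.Lattice.Structures using (IsDistributiveLattice)
open import Data.Nat using (ℕ)
open import Data.Fin using (Fin)
open import Data.Product using (Σ; ∃; _×_)

record CoHeytingAlgebra (c ℓ : Level) : Set (lsuc (c ⊔ ℓ)) where
  infixr 7 _∧_
  infixr 6 _∨_
  infixl 6 _-_
  infix 4 _≈_ _≤_
  field
    Carrier : Set c
    _≈_ : Rel Carrier ℓ
    _∨_ : Op₂ Carrier
    _∧_ : Op₂ Carrier
    _-_ : Op₂ Carrier
    𝟎 : Carrier
    𝟏 : Carrier
    isDistributiveLattice : IsDistributiveLattice _≈_ _∨_ _∧_
    ∨-identityʳ : ∀ x → (x ∨ 𝟎) ≈ x
    ∧-identityʳ : ∀ x → (x ∧ 𝟏) ≈ x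
    -‿cong : Congruent₂ _≈_ _-_

  _≤_ : Rel Carrier ℓ
  x ≤ y = (x ∧ y) ≈ x

  field
    -‿upper : ∀ a b → a ≤ (b ∨ (a - b))
    -‿least : ∀ a b c → a ≤ (b ∨ c) → (a - b) ≤ c

  _≪_ : Rel Carrier ℓ
  b ≪ a = ((a - b) ≈ a) × (b ≤ a)

Finite : ∀ {c ℓ} → CoHeytingAlgebra c ℓ → Set (c ⊔ ℓ)
Finite L = ∃ λ (n : ℕ) → Σ (Fin n → Carrier) λ f → ∀ x → ∃ λ i → f i ≈ x
  where open CoHeytingAlgebra L

-- An embedding of co-Heyting algebras: an injective map preserving
-- 𝟎, 𝟏, ∨, ∧, - (so that its image is a subalgebra isomorphic to L).
record Embedding {c ℓ c' ℓ'} (L : CoHeytingAlgebra c ℓ) (L' : CoHeytingAlgebra c' ℓ')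
       : Set (c ⊔ ℓ ⊔ c' ⊔ ℓ') where
  private
    module A = CoHeytingAlgebra L
    module B = CoHeytingAlgebra L'
  field
    ⟦_⟧ : A.Carrier → B.Carrier
    cong : ∀ {x y} → x A.≈ y → ⟦ x ⟧ B.≈ ⟦ y ⟧
    injective : ∀ {x y} → ⟦ x ⟧ B.≈ ⟦ y ⟧ → x A.≈ y
    pres-𝟎 : ⟦ A.𝟎 ⟧ B.≈ B.𝟎
    pres-𝟏 : ⟦ A.𝟏 ⟧ B.≈ B.𝟏
    pres-∨ : ∀ x y → ⟦ x A.∨ y ⟧ B.≈ (⟦ x ⟧ B.∨ ⟦ y ⟧)
    pres-∧ : ∀ x y → ⟦ x A.∧ y ⟧ B.≈ (⟦ x ⟧ B.∧ ⟦ y ⟧)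
    pres-- : ∀ x y → ⟦ x A.- y ⟧ B.≈ (⟦ x ⟧ B.- ⟦ y ⟧)

-- Put b = b₁ ∧ b₂.  The extension L' consists of the triples (z , x , y) with
-- z ≤ b, b₂ ≤ x, b₁ ≤ y, (x - b₂) ∧ b ≤ z and (y - b₁) ∧ b ≤ z, ordered
-- componentwise: a sublattice of [0,b] × [b₂,1] × [b₁,1] in which differences
-- are computed componentwise and then enlarged in z just enough to stay
-- admissible.  L embeds by w ↦ (w ∧ b , w ∨ b₂ , w ∨ b₁), which is injective
-- because, by distributivity, w is determined by w ∧ b and w ∨ b.  The element
-- a splits as a₁ = (b , a , b₁) and a₂ = (b , b₂ , a): the hypothesis
-- a - (b₁ ∨ b₂) = a gives a ≤ (a ∨ bᵢ) - bᵢ, which is what makes a - a₂ = a₁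
-- and a - a₁ = a₂, and a ≠ 𝟎 means a ≰ b₁ ∨ b₂, so a₁ and a₂ are non-zero.
module Submission where

open import Defs
open import Data.Nat using (_*_)
open import Data.Fin using (Fin; combine; remQuot)
open import Data.Fin.Properties using (remQuot-combine)
open import Data.Product using (Σ; ∃; _×_; _,_; proj₁; proj₂)
open import Relation.Binary.Bundles using (Poset)
open import Relation.Binary.PropositionalEquality using (_≡_; subst; sym; trans; cong)
open import Relation.Nullary using (¬_)
open import Algebra.Lattice.Structures using (IsDistributiveLattice)
import Relation.Binary.Reasoning.PartialOrder as PosetReasoning

module CoHeytingProperties {c ℓ} (L : CoHeytingAlgebra c ℓ) where
  open CoHeytingAlgebra L public
  open IsDistributiveLattice isDistributiveLattice public
    renaming (refl to ≈-refl; sym to ≈-sym; trans to ≈-trans)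

  ∧-idem : ∀ x → x ∧ x ≈ x
  ∧-idem x = ≈-trans (∧-congˡ (≈-sym (∨-absorbs-∧ x x))) (∧-absorbs-∨ x (x ∧ x))

  ≤-reflexive : ∀ {x y} → x ≈ y → x ≤ y
  ≤-reflexive {x} x≈y = ≈-trans (∧-congˡ (≈-sym x≈y)) (∧-idem x)

  ≤-refl : ∀ {x} → x ≤ x
  ≤-refl {x} = ∧-idem x

  ≤-trans : ∀ {x y z} → x ≤ y → y ≤ z → x ≤ z
  ≤-trans {x} {y} {z} x≤y y≤z =
    ≈-trans (∧-congʳ (≈-sym x≤y)) (≈-trans (∧-assoc x y z) (≈-trans (∧-congˡ y≤z) x≤y))

  ≤-antisym : ∀ {x y} → x ≤ y → y ≤ x → x ≈ y
  ≤-antisym {x} {y} x≤y y≤x = ≈-trans (≈-sym x≤y) (≈-trans (∧-comm x y) y≤x)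

  poset : Poset c ℓ ℓ
  poset = record
    { isPartialOrder = record
      { isPreorder = record
        { isEquivalence = isEquivalence ; reflexive = ≤-reflexive ; trans = ≤-trans }
      ; antisym = ≤-antisym } }

  open PosetReasoning poset

  x∧y≤x : ∀ x y → x ∧ y ≤ x
  x∧y≤x x y = ≈-trans (∧-assoc x y x) (≈-trans (∧-congˡ (∧-comm y x))
     (≈-trans (≈-sym (∧-assoc x x y)) (∧-congʳ (∧-idem x))))

  x∧y≤y : ∀ x y → x ∧ y ≤ y
  x∧y≤y x y = ≈-trans (∧-assoc x y y) (∧-congˡ (∧-idem y))

  ∧-greatest : ∀ {x y z} → z ≤ x → z ≤ y → z ≤ x ∧ y
  ∧-greatest {x} {y} {z} z≤x z≤y = ≈-trans (≈-sym (∧-assoc z x y)) (≈-trans (∧-congʳ z≤x) z≤y)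

  x≤x∨y : ∀ x y → x ≤ x ∨ y
  x≤x∨y x y = ∧-absorbs-∨ x y

  y≤x∨y : ∀ x y → y ≤ x ∨ y
  y≤x∨y x y = ≈-trans (∧-congˡ (∨-comm x y)) (∧-absorbs-∨ y x)

  ∨-least : ∀ {x y z} → x ≤ z → y ≤ z → x ∨ y ≤ z
  ∨-least {x} {y} {z} x≤z y≤z = ≈-trans (∧-distribʳ-∨ z x y) (∨-cong x≤z y≤z)

  ∧-mono : ∀ {x y x' y'} → x ≤ x' → y ≤ y' → x ∧ y ≤ x' ∧ y'
  ∧-mono {x} {y} x≤x' y≤y' = ∧-greatest (≤-trans (x∧y≤x x y) x≤x') (≤-trans (x∧y≤y x y) y≤y')

  ∨-mono : ∀ {x y x' y'} → x ≤ x' → y ≤ y' → x ∨ y ≤ x' ∨ y'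
  ∨-mono {x' = x'} {y'} x≤x' y≤y' =
    ∨-least (≤-trans x≤x' (x≤x∨y x' y')) (≤-trans y≤y' (y≤x∨y x' y'))

  y≤x⇒x∨y≈x : ∀ {x y} → y ≤ x → x ∨ y ≈ x
  y≤x⇒x∨y≈x {x} {y} y≤x = ≤-antisym (∨-least ≤-refl y≤x) (x≤x∨y x y)

  𝟎≤ : ∀ x → 𝟎 ≤ x
  𝟎≤ x = ≤-trans (y≤x∨y x 𝟎) (≤-reflexive (∨-identityʳ x))

  ≤𝟏 : ∀ x → x ≤ 𝟏
  ≤𝟏 = ∧-identityʳ

  ≤𝟎⇒≈𝟎 : ∀ {x} → x ≤ 𝟎 → x ≈ 𝟎
  ≤𝟎⇒≈𝟎 {x} x≤𝟎 = ≤-antisym x≤𝟎 (𝟎≤ x)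

  ≤∨⇒-≤ : ∀ {x y z} → x ≤ y ∨ z → x - y ≤ z
  ≤∨⇒-≤ {x} {y} {z} = -‿least x y z

  -‿mono : ∀ {x x' y y'} → x ≤ x' → y' ≤ y → x - y ≤ x' - y'
  -‿mono {x' = x'} {y' = y'} x≤x' y'≤y =
    ≤∨⇒-≤ (≤-trans x≤x' (≤-trans (-‿upper x' y') (∨-mono y'≤y ≤-refl)))

  x-y≤x : ∀ x y → x - y ≤ x
  x-y≤x x y = ≤∨⇒-≤ (y≤x∨y y x)

  x≤y⇒x-y≤𝟎 : ∀ {x y} → x ≤ y → x - y ≤ 𝟎
  x≤y⇒x-y≤𝟎 {y = y} x≤y = ≤∨⇒-≤ (≤-trans x≤y (≤-reflexive (≈-sym (∨-identityʳ y))))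

  [x∨y]-y≤x : ∀ x y → (x ∨ y) - y ≤ x
  [x∨y]-y≤x x y = ≤∨⇒-≤ (≤-reflexive (∨-comm x y))

  [x∨y]-z≤[x-z]∨[y-z] : ∀ x y z → (x ∨ y) - z ≤ (x - z) ∨ (y - z)
  [x∨y]-z≤[x-z]∨[y-z] x y z = ≤∨⇒-≤ (∨-least
    (≤-trans (-‿upper x z) (∨-mono ≤-refl (x≤x∨y _ _)))
    (≤-trans (-‿upper y z) (∨-mono ≤-refl (y≤x∨y _ _))))

  [x∨z]-[y∨z]≤x-y : ∀ x y z → (x ∨ z) - (y ∨ z) ≤ x - y
  [x∨z]-[y∨z]≤x-y x y z = ≤∨⇒-≤ (∨-least
    (≤-trans (-‿upper x y) (∨-mono (x≤x∨y y z) ≤-refl))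
    (≤-trans (y≤x∨y y z) (x≤x∨y _ _)))

  x≤y∨z⇒x-y≤z-w : ∀ {x y z w} → w ≤ y → x ≤ y ∨ z → x - y ≤ z - w
  x≤y∨z⇒x-y≤z-w {x} {y} {z} {w} w≤y x≤y∨z = ≤∨⇒-≤ (begin
    x                 ≤⟨ x≤y∨z ⟩
    y ∨ z             ≤⟨ ∨-mono ≤-refl (-‿upper z w) ⟩
    y ∨ (w ∨ (z - w)) ≈⟨ ≈-sym (∨-assoc y w (z - w)) ⟩
    (y ∨ w) ∨ (z - w) ≈⟨ ∨-congʳ (y≤x⇒x∨y≈x w≤y) ⟩
    y ∨ (z - w)       ∎)

  [x∧y]∧z≈[x∧z]∧[y∧z] : ∀ x y z → (x ∧ y) ∧ z ≈ (x ∧ z) ∧ (y ∧ z)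
  [x∧y]∧z≈[x∧z]∧[y∧z] x y z = ≤-antisym
    (∧-greatest (∧-mono (x∧y≤x _ _) ≤-refl) (∧-mono (x∧y≤y _ _) ≤-refl))
    (∧-greatest (∧-mono (x∧y≤x _ _) (x∧y≤x _ _)) (≤-trans (x∧y≤y _ _) (x∧y≤y _ _)))

  [x∨y]∨z≈[x∨z]∨[y∨z] : ∀ x y z → (x ∨ y) ∨ z ≈ (x ∨ z) ∨ (y ∨ z)
  [x∨y]∨z≈[x∨z]∨[y∨z] x y z = ≤-antisym
    (∨-least (∨-mono (x≤x∨y x z) (x≤x∨y y z)) (≤-trans (y≤x∨y y z) (y≤x∨y _ _)))
    (∨-least (∨-mono (x≤x∨y x y) ≤-refl) (∨-mono (y≤x∨y x y) ≤-refl))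

  [x-y]∨z≈[[x∨z]-[y∨z]]∨z : ∀ x y z → (x - y) ∨ z ≈ ((x ∨ z) - (y ∨ z)) ∨ z
  [x-y]∨z≈[[x∨z]-[y∨z]]∨z x y z = ≤-antisym
    (∨-least (≤∨⇒-≤ (begin
       x                                 ≤⟨ x≤x∨y x z ⟩
       x ∨ z                             ≤⟨ -‿upper (x ∨ z) (y ∨ z) ⟩
       (y ∨ z) ∨ ((x ∨ z) - (y ∨ z))     ≤⟨ ∨-least (∨-mono ≤-refl (y≤x∨y _ _))
                                                      (≤-trans (x≤x∨y _ z) (y≤x∨y _ _)) ⟩
       y ∨ (((x ∨ z) - (y ∨ z)) ∨ z)     ∎)) (y≤x∨y _ _))
    (∨-mono ([x∨z]-[y∨z]≤x-y x y z) ≤-refl)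

  [x∧z]-[y∧z]≤x-y : ∀ x y z → (x ∧ z) - (y ∧ z) ≤ x - y
  [x∧z]-[y∧z]≤x-y x y z = ≤∨⇒-≤ (begin
    x ∧ z                     ≤⟨ ∧-mono (-‿upper x y) ≤-refl ⟩
    (y ∨ (x - y)) ∧ z         ≈⟨ ∧-distribʳ-∨ z y (x - y) ⟩
    (y ∧ z) ∨ ((x - y) ∧ z)   ≤⟨ ∨-mono ≤-refl (x∧y≤x _ _) ⟩
    (y ∧ z) ∨ (x - y)         ∎)

  x∧z≤y⇒x∨z≤y∨z⇒x≤y : ∀ {x y} z → x ∧ z ≤ y → x ∨ z ≤ y ∨ z → x ≤ y
  x∧z≤y⇒x∨z≤y∨z⇒x≤y {x} {y} z x∧z≤y x∨z≤y∨z = begin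
    x                 ≈⟨ ≈-sym (∧-absorbs-∨ x z) ⟩
    x ∧ (x ∨ z)       ≤⟨ ∧-mono ≤-refl x∨z≤y∨z ⟩
    x ∧ (y ∨ z)       ≈⟨ ∧-distribˡ-∨ x y z ⟩
    (x ∧ y) ∨ (x ∧ z) ≤⟨ ∨-least (x∧y≤y x y) x∧z≤y ⟩
    y                 ∎

module Triples {c ℓ} (L : CoHeytingAlgebra c ℓ) (b₁ b₂ : CoHeytingAlgebra.Carrier L) where
  open CoHeytingProperties L public
  open PosetReasoning poset

  b : Carrier
  b = b₁ ∧ b₂

  record Triple : Set c where
    constructor ⟨_,_,_⟩
    field
      z x y : Carrier
  open Triple public

  infix 4 _≈³_ _≤³_
  _≈³_ : Triple → Triple → Set ℓ
  t ≈³ s = (z t ≈ z s) × (x t ≈ x s) × (y t ≈ y s)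

  _≤³_ : Triple → Triple → Set ℓ
  t ≤³ s = (z t ≤ z s) × (x t ≤ x s) × (y t ≤ y s)

  ≈³-refl : ∀ {t} → t ≈³ t
  ≈³-refl = ≈-refl , ≈-refl , ≈-refl

  ≈³-sym : ∀ {t s} → t ≈³ s → s ≈³ t
  ≈³-sym (p , q , r) = ≈-sym p , ≈-sym q , ≈-sym r

  infixr 4 _⟫_
  _⟫_ : ∀ {t s u} → t ≈³ s → s ≈³ u → t ≈³ u
  (p , q , r) ⟫ (p' , q' , r') = ≈-trans p p' , ≈-trans q q' , ≈-trans r r'

  ≤³-reflexive : ∀ {t s} → t ≈³ s → t ≤³ s
  ≤³-reflexive (p , q , r) = ≤-reflexive p , ≤-reflexive q , ≤-reflexive r

  ≤³-trans : ∀ {t s u} → t ≤³ s → s ≤³ u → t ≤³ u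
  ≤³-trans (p , q , r) (p' , q' , r') = ≤-trans p p' , ≤-trans q q' , ≤-trans r r'

  record Admissible (t : Triple) : Set ℓ where
    field
      z≤b : z t ≤ b
      b₂≤x : b₂ ≤ x t
      b₁≤y : b₁ ≤ y t
      [x-b₂]∧b≤z : (x t - b₂) ∧ b ≤ z t
      [y-b₁]∧b≤z : (y t - b₁) ∧ b ≤ z t
  open Admissible public

  normalise : Triple → Triple
  normalise ⟨ z₀ , x₀ , y₀ ⟩ =
    ⟨ (z₀ ∧ b) ∨ ((((x₀ ∨ b₂) - b₂) ∧ b) ∨ (((y₀ ∨ b₁) - b₁) ∧ b)) , x₀ ∨ b₂ , y₀ ∨ b₁ ⟩

  normalise-admissible : ∀ t → Admissible (normalise t)
  normalise-admissible t = record
    { z≤b = ∨-least (x∧y≤y _ _) (∨-least (x∧y≤y _ _) (x∧y≤y _ _))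
    ; b₂≤x = y≤x∨y _ _
    ; b₁≤y = y≤x∨y _ _
    ; [x-b₂]∧b≤z = ≤-trans (x≤x∨y _ _) (y≤x∨y _ _)
    ; [y-b₁]∧b≤z = ≤-trans (y≤x∨y _ _) (y≤x∨y _ _) }

  admissible⇒normalise≈ : ∀ {t} → Admissible t → normalise t ≈³ t
  admissible⇒normalise≈ {⟨ z₀ , x₀ , y₀ ⟩} adm =
    ≤-antisym normal-z≤z (≤-trans (∧-greatest ≤-refl (z≤b adm)) (x≤x∨y _ _)) ,
    y≤x⇒x∨y≈x (b₂≤x adm) ,
    y≤x⇒x∨y≈x (b₁≤y adm)
    where
    normal-z≤z : (z₀ ∧ b) ∨ ((((x₀ ∨ b₂) - b₂) ∧ b) ∨ (((y₀ ∨ b₁) - b₁) ∧ b)) ≤ z₀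
    normal-z≤z = ∨-least (x∧y≤x _ _) (∨-least
      (≤-trans (∧-mono (-‿mono (≤-reflexive (y≤x⇒x∨y≈x (b₂≤x adm))) ≤-refl) ≤-refl) ([x-b₂]∧b≤z adm))
      (≤-trans (∧-mono (-‿mono (≤-reflexive (y≤x⇒x∨y≈x (b₁≤y adm))) ≤-refl) ≤-refl) ([y-b₁]∧b≤z adm)))

  normalise-cong : ∀ {t s} → t ≈³ s → normalise t ≈³ normalise s
  normalise-cong (p , q , r) =
    ∨-cong (∧-congʳ p) (∨-cong (∧-congʳ (-‿cong (∨-congʳ q) ≈-refl)) (∧-congʳ (-‿cong (∨-congʳ r) ≈-refl))) ,
    ∨-congʳ q , ∨-congʳ r

  infixr 6 _⊔_
  infixr 7 _⊓_
  _⊔_ : Triple → Triple → Triple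
  t ⊔ s = ⟨ z t ∨ z s , x t ∨ x s , y t ∨ y s ⟩

  _⊓_ : Triple → Triple → Triple
  t ⊓ s = ⟨ z t ∧ z s , x t ∧ x s , y t ∧ y s ⟩

  diff : Triple → Triple → Triple
  diff t s = ⟨ (z t - z s) ∨ (((x t - x s) ∧ b) ∨ ((y t - y s) ∧ b)) , (x t - x s) ∨ b₂ , (y t - y s) ∨ b₁ ⟩

  ⊔-cong : ∀ {t t' s s'} → t ≈³ t' → s ≈³ s' → t ⊔ s ≈³ t' ⊔ s'
  ⊔-cong (p , q , r) (p' , q' , r') = ∨-cong p p' , ∨-cong q q' , ∨-cong r r'

  ⊓-cong : ∀ {t t' s s'} → t ≈³ t' → s ≈³ s' → t ⊓ s ≈³ t' ⊓ s'
  ⊓-cong (p , q , r) (p' , q' , r') = ∧-cong p p' , ∧-cong q q' , ∧-cong r r'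

  diff-cong : ∀ {t t' s s'} → t ≈³ t' → s ≈³ s' → diff t s ≈³ diff t' s'
  diff-cong (p , q , r) (p' , q' , r') =
    ∨-cong (-‿cong p p') (∨-cong (∧-congʳ (-‿cong q q')) (∧-congʳ (-‿cong r r'))) ,
    ∨-congʳ (-‿cong q q') , ∨-congʳ (-‿cong r r')

  ⊔-admissible : ∀ {t s} → Admissible t → Admissible s → Admissible (t ⊔ s)
  ⊔-admissible at as = record
    { z≤b = ∨-least (z≤b at) (z≤b as)
    ; b₂≤x = ≤-trans (b₂≤x at) (x≤x∨y _ _)
    ; b₁≤y = ≤-trans (b₁≤y at) (x≤x∨y _ _)
    ; [x-b₂]∧b≤z = bound ([x-b₂]∧b≤z at) ([x-b₂]∧b≤z as)
    ; [y-b₁]∧b≤z = bound ([y-b₁]∧b≤z at) ([y-b₁]∧b≤z as) }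
    where
    bound : ∀ {u v w u' v'} → (u - w) ∧ b ≤ u' → (v - w) ∧ b ≤ v' → ((u ∨ v) - w) ∧ b ≤ u' ∨ v'
    bound {u} {v} {w} u-w≤ v-w≤ = begin
      ((u ∨ v) - w) ∧ b                ≤⟨ ∧-mono ([x∨y]-z≤[x-z]∨[y-z] u v w) ≤-refl ⟩
      ((u - w) ∨ (v - w)) ∧ b          ≈⟨ ∧-distribʳ-∨ b (u - w) (v - w) ⟩
      ((u - w) ∧ b) ∨ ((v - w) ∧ b)    ≤⟨ ∨-mono u-w≤ v-w≤ ⟩
      _                                ∎

  ⊓-admissible : ∀ {t s} → Admissible t → Admissible s → Admissible (t ⊓ s)
  ⊓-admissible at as = record
    { z≤b = ≤-trans (x∧y≤x _ _) (z≤b at)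
    ; b₂≤x = ∧-greatest (b₂≤x at) (b₂≤x as)
    ; b₁≤y = ∧-greatest (b₁≤y at) (b₁≤y as)
    ; [x-b₂]∧b≤z = bound ([x-b₂]∧b≤z at) ([x-b₂]∧b≤z as)
    ; [y-b₁]∧b≤z = bound ([y-b₁]∧b≤z at) ([y-b₁]∧b≤z as) }
    where
    bound : ∀ {u v w u' v'} → (u - w) ∧ b ≤ u' → (v - w) ∧ b ≤ v' → ((u ∧ v) - w) ∧ b ≤ u' ∧ v'
    bound u-w≤ v-w≤ = ∧-greatest
      (≤-trans (∧-mono (-‿mono (x∧y≤x _ _) ≤-refl) ≤-refl) u-w≤)
      (≤-trans (∧-mono (-‿mono (x∧y≤y _ _) ≤-refl) ≤-refl) v-w≤)

  diff-admissible : ∀ {t s} → Admissible t → Admissible (diff t s)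
  diff-admissible at = record
    { z≤b = ∨-least (≤-trans (x-y≤x _ _) (z≤b at)) (∨-least (x∧y≤y _ _) (x∧y≤y _ _))
    ; b₂≤x = y≤x∨y _ _
    ; b₁≤y = y≤x∨y _ _
    ; [x-b₂]∧b≤z = ≤-trans (∧-mono ([x∨y]-y≤x _ _) ≤-refl) (≤-trans (x≤x∨y _ _) (y≤x∨y _ _))
    ; [y-b₁]∧b≤z = ≤-trans (∧-mono ([x∨y]-y≤x _ _) ≤-refl) (≤-trans (y≤x∨y _ _) (y≤x∨y _ _)) }

  diff-upper : ∀ t s → t ≤³ s ⊔ diff t s
  diff-upper t s =
    ≤-trans (-‿upper _ _) (∨-mono ≤-refl (x≤x∨y _ _)) ,
    ≤-trans (-‿upper _ _) (∨-mono ≤-refl (x≤x∨y _ _)) ,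
    ≤-trans (-‿upper _ _) (∨-mono ≤-refl (x≤x∨y _ _))

  diff-least : ∀ {t s r} → Admissible s → Admissible r → t ≤³ s ⊔ r → diff t s ≤³ r
  diff-least as ar (p , q , w) =
    ∨-least (≤∨⇒-≤ p) (∨-least
      (≤-trans (∧-mono (x≤y∨z⇒x-y≤z-w (b₂≤x as) q) ≤-refl) ([x-b₂]∧b≤z ar))
      (≤-trans (∧-mono (x≤y∨z⇒x-y≤z-w (b₁≤y as) w) ≤-refl) ([y-b₁]∧b≤z ar))) ,
    ∨-least (≤∨⇒-≤ q) (b₂≤x ar) ,
    ∨-least (≤∨⇒-≤ w) (b₁≤y ar)

-- Admissible triples as a Σ-type would live in Set (c ⊔ ℓ); instead every
-- triple is an element, and triples are identified when their normalisations agree.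
module Glued {c ℓ} (L : CoHeytingAlgebra c ℓ) (b₁ b₂ : CoHeytingAlgebra.Carrier L) where
  open Triples L b₁ b₂ public

  infix 4 _≈ᴳ_
  _≈ᴳ_ : Triple → Triple → Set ℓ
  t ≈ᴳ s = normalise t ≈³ normalise s

  infixr 6 _∨ᴳ_
  infixr 7 _∧ᴳ_
  infixl 6 _-ᴳ_
  _∨ᴳ_ _∧ᴳ_ _-ᴳ_ : Triple → Triple → Triple
  t ∨ᴳ s = normalise t ⊔ normalise s
  t ∧ᴳ s = normalise t ⊓ normalise s
  t -ᴳ s = diff (normalise t) (normalise s)

  𝟎ᴳ 𝟏ᴳ : Triple
  𝟎ᴳ = ⟨ 𝟎 , b₂ , b₁ ⟩
  𝟏ᴳ = ⟨ b , 𝟏 , 𝟏 ⟩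

  𝟎ᴳ-admissible : Admissible 𝟎ᴳ
  𝟎ᴳ-admissible = record
    { z≤b = 𝟎≤ _ ; b₂≤x = ≤-refl ; b₁≤y = ≤-refl
    ; [x-b₂]∧b≤z = ≤-trans (x∧y≤x _ _) (x≤y⇒x-y≤𝟎 ≤-refl)
    ; [y-b₁]∧b≤z = ≤-trans (x∧y≤x _ _) (x≤y⇒x-y≤𝟎 ≤-refl) }

  𝟏ᴳ-admissible : Admissible 𝟏ᴳ
  𝟏ᴳ-admissible = record
    { z≤b = ≤-refl ; b₂≤x = ≤𝟏 _ ; b₁≤y = ≤𝟏 _ ; [x-b₂]∧b≤z = x∧y≤y _ _ ; [y-b₁]∧b≤z = x∧y≤y _ _ }

  ≈³⇒≈ᴳ : ∀ {t s} → Admissible t → Admissible s → t ≈³ s → t ≈ᴳ s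
  ≈³⇒≈ᴳ at as t≈s = admissible⇒normalise≈ at ⟫ t≈s ⟫ ≈³-sym (admissible⇒normalise≈ as)

  ≈ᴳ⇒≈³ : ∀ {t s} → Admissible t → Admissible s → t ≈ᴳ s → t ≈³ s
  ≈ᴳ⇒≈³ at as t≈s = ≈³-sym (admissible⇒normalise≈ at) ⟫ t≈s ⟫ admissible⇒normalise≈ as

  normalise-∨ᴳ : ∀ t s → normalise (t ∨ᴳ s) ≈³ normalise t ⊔ normalise s
  normalise-∨ᴳ t s = admissible⇒normalise≈
    (⊔-admissible (normalise-admissible t) (normalise-admissible s))

  normalise-∧ᴳ : ∀ t s → normalise (t ∧ᴳ s) ≈³ normalise t ⊓ normalise s
  normalise-∧ᴳ t s = admissible⇒normalise≈
    (⊓-admissible (normalise-admissible t) (normalise-admissible s))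

  normalise-diff : ∀ t s → normalise (t -ᴳ s) ≈³ diff (normalise t) (normalise s)
  normalise-diff t s = admissible⇒normalise≈ (diff-admissible (normalise-admissible t))

  ≤³⇒≤ᴳ : ∀ {t s} → normalise t ≤³ normalise s → t ∧ᴳ s ≈ᴳ t
  ≤³⇒≤ᴳ {t} {s} t≤s = normalise-∧ᴳ t s ⟫ t≤s

  admissible-≤³⇒≤ᴳ : ∀ {t s} → Admissible t → Admissible s → t ≤³ s → t ∧ᴳ s ≈ᴳ t
  admissible-≤³⇒≤ᴳ at as t≤s = ≤³⇒≤ᴳ (≤³-trans (≤³-reflexive (admissible⇒normalise≈ at))
    (≤³-trans t≤s (≤³-reflexive (≈³-sym (admissible⇒normalise≈ as)))))

  ≤ᴳ⇒≤³ : ∀ {t s} → t ∧ᴳ s ≈ᴳ t → normalise t ≤³ normalise s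
  ≤ᴳ⇒≤³ {t} {s} t≤s = ≈³-sym (normalise-∧ᴳ t s) ⟫ t≤s

  -- Each lattice law of L', read after normalisation, is the law of L in every coordinate.
  isDistributiveLatticeᴳ : IsDistributiveLattice _≈ᴳ_ _∨ᴳ_ _∧ᴳ_
  isDistributiveLatticeᴳ = record
    { isLattice = record
      { isEquivalence = record { refl = ≈³-refl ; sym = ≈³-sym ; trans = _⟫_ }
      ; ∨-comm = λ t s →
          normalise-∨ᴳ t s ⟫ (∨-comm _ _ , ∨-comm _ _ , ∨-comm _ _) ⟫ ≈³-sym (normalise-∨ᴳ s t)
      ; ∨-assoc = λ t s r →
          normalise-∨ᴳ _ r ⟫ ⊔-cong (normalise-∨ᴳ t s) ≈³-refl ⟫
          (∨-assoc _ _ _ , ∨-assoc _ _ _ , ∨-assoc _ _ _) ⟫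
          ≈³-sym (normalise-∨ᴳ t _ ⟫ ⊔-cong ≈³-refl (normalise-∨ᴳ s r))
      ; ∨-cong = λ p q → normalise-∨ᴳ _ _ ⟫ ⊔-cong p q ⟫ ≈³-sym (normalise-∨ᴳ _ _)
      ; ∧-comm = λ t s →
          normalise-∧ᴳ t s ⟫ (∧-comm _ _ , ∧-comm _ _ , ∧-comm _ _) ⟫ ≈³-sym (normalise-∧ᴳ s t)
      ; ∧-assoc = λ t s r →
          normalise-∧ᴳ _ r ⟫ ⊓-cong (normalise-∧ᴳ t s) ≈³-refl ⟫
          (∧-assoc _ _ _ , ∧-assoc _ _ _ , ∧-assoc _ _ _) ⟫
          ≈³-sym (normalise-∧ᴳ t _ ⟫ ⊓-cong ≈³-refl (normalise-∧ᴳ s r))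
      ; ∧-cong = λ p q → normalise-∧ᴳ _ _ ⟫ ⊓-cong p q ⟫ ≈³-sym (normalise-∧ᴳ _ _)
      ; absorptive =
          (λ t s → normalise-∨ᴳ t _ ⟫ ⊔-cong ≈³-refl (normalise-∧ᴳ t s) ⟫
                   (∨-absorbs-∧ _ _ , ∨-absorbs-∧ _ _ , ∨-absorbs-∧ _ _)) ,
          (λ t s → normalise-∧ᴳ t _ ⟫ ⊓-cong ≈³-refl (normalise-∨ᴳ t s) ⟫
                   (∧-absorbs-∨ _ _ , ∧-absorbs-∨ _ _ , ∧-absorbs-∨ _ _))
      }
    ; ∨-distrib-∧ =
        (λ t s r → normalise-∨ᴳ t _ ⟫ ⊔-cong ≈³-refl (normalise-∧ᴳ s r) ⟫
          (∨-distribˡ-∧ _ _ _ , ∨-distribˡ-∧ _ _ _ , ∨-distribˡ-∧ _ _ _) ⟫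
          ≈³-sym (normalise-∧ᴳ _ _ ⟫ ⊓-cong (normalise-∨ᴳ t s) (normalise-∨ᴳ t r))) ,
        (λ t s r → normalise-∨ᴳ _ t ⟫ ⊔-cong (normalise-∧ᴳ s r) ≈³-refl ⟫
          (∨-distribʳ-∧ _ _ _ , ∨-distribʳ-∧ _ _ _ , ∨-distribʳ-∧ _ _ _) ⟫
          ≈³-sym (normalise-∧ᴳ _ _ ⟫ ⊓-cong (normalise-∨ᴳ s t) (normalise-∨ᴳ r t)))
    ; ∧-distrib-∨ =
        (λ t s r → normalise-∧ᴳ t _ ⟫ ⊓-cong ≈³-refl (normalise-∨ᴳ s r) ⟫
          (∧-distribˡ-∨ _ _ _ , ∧-distribˡ-∨ _ _ _ , ∧-distribˡ-∨ _ _ _) ⟫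
          ≈³-sym (normalise-∨ᴳ _ _ ⟫ ⊔-cong (normalise-∧ᴳ t s) (normalise-∧ᴳ t r))) ,
        (λ t s r → normalise-∧ᴳ _ t ⟫ ⊓-cong (normalise-∨ᴳ s r) ≈³-refl ⟫
          (∧-distribʳ-∨ _ _ _ , ∧-distribʳ-∨ _ _ _ , ∧-distribʳ-∨ _ _ _) ⟫
          ≈³-sym (normalise-∨ᴳ _ _ ⟫ ⊔-cong (normalise-∧ᴳ s t) (normalise-∧ᴳ r t)))
    }

  glued : CoHeytingAlgebra c ℓ
  glued = record
    { Carrier = Triple ; _≈_ = _≈ᴳ_ ; _∨_ = _∨ᴳ_ ; _∧_ = _∧ᴳ_ ; _-_ = _-ᴳ_ ; 𝟎 = 𝟎ᴳ ; 𝟏 = 𝟏ᴳ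
    ; isDistributiveLattice = isDistributiveLatticeᴳ
    ; ∨-identityʳ = λ t → normalise-∨ᴳ t 𝟎ᴳ ⟫ ⊔-cong ≈³-refl (admissible⇒normalise≈ 𝟎ᴳ-admissible) ⟫
        (∨-identityʳ _ , y≤x⇒x∨y≈x (b₂≤x (normalise-admissible t)) , y≤x⇒x∨y≈x (b₁≤y (normalise-admissible t)))
    ; ∧-identityʳ = λ t → normalise-∧ᴳ t 𝟏ᴳ ⟫ ⊓-cong ≈³-refl (admissible⇒normalise≈ 𝟏ᴳ-admissible) ⟫
        (z≤b (normalise-admissible t) , ∧-identityʳ _ , ∧-identityʳ _)
    ; -‿cong = λ p q → normalise-diff _ _ ⟫ diff-cong p q ⟫ ≈³-sym (normalise-diff _ _)
    ; -‿upper = λ t s → ≤³⇒≤ᴳ (≤³-trans (diff-upper (normalise t) (normalise s))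
        (≤³-reflexive (≈³-sym (normalise-∨ᴳ s _ ⟫ ⊔-cong ≈³-refl (normalise-diff t s)))))
    ; -‿least = λ t s r t≤s∨r → ≤³⇒≤ᴳ (≤³-trans (≤³-reflexive (normalise-diff t s))
        (diff-least (normalise-admissible s) (normalise-admissible r)
          (≤³-trans (≤ᴳ⇒≤³ t≤s∨r) (≤³-reflexive (normalise-∨ᴳ s r)))))
    }

module Embed {c ℓ} (L : CoHeytingAlgebra c ℓ) (b₁ b₂ : CoHeytingAlgebra.Carrier L) where
  open Glued L b₁ b₂ public
  open PosetReasoning poset

  embed : Carrier → Triple
  embed w = ⟨ w ∧ b , w ∨ b₂ , w ∨ b₁ ⟩

  embed-admissible : ∀ w → Admissible (embed w)
  embed-admissible w = record
    { z≤b = x∧y≤y _ _ ; b₂≤x = y≤x∨y _ _ ; b₁≤y = y≤x∨y _ _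
    ; [x-b₂]∧b≤z = ∧-mono ([x∨y]-y≤x w b₂) ≤-refl
    ; [y-b₁]∧b≤z = ∧-mono ([x∨y]-y≤x w b₁) ≤-refl }

  normalise-embed : ∀ w → normalise (embed w) ≈³ embed w
  normalise-embed w = admissible⇒normalise≈ (embed-admissible w)

  ∨b-mono : ∀ {w w'} → w ∨ b₁ ≤ w' ∨ b₁ → w ∨ b₂ ≤ w' ∨ b₂ → w ∨ b ≤ w' ∨ b
  ∨b-mono {w} {w'} ≤₁ ≤₂ = begin
    w ∨ b                     ≈⟨ ∨-distribˡ-∧ w b₁ b₂ ⟩
    (w ∨ b₁) ∧ (w ∨ b₂)       ≤⟨ ∧-mono ≤₁ ≤₂ ⟩
    (w' ∨ b₁) ∧ (w' ∨ b₂)     ≈⟨ ≈-sym (∨-distribˡ-∧ w' b₁ b₂) ⟩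
    w' ∨ b                    ∎

  embed-reflects-≤ : ∀ {w w'} → embed w ≤³ embed w' → w ≤ w'
  embed-reflects-≤ (p , q , r) = x∧z≤y⇒x∨z≤y∨z⇒x≤y b (≤-trans p (x∧y≤x _ _)) (∨b-mono r q)

  embed-∨ : ∀ w w' → embed (w ∨ w') ≈³ embed w ⊔ embed w'
  embed-∨ w w' = ∧-distribʳ-∨ b w w' , [x∨y]∨z≈[x∨z]∨[y∨z] w w' b₂ , [x∨y]∨z≈[x∨z]∨[y∨z] w w' b₁

  embed-∧ : ∀ w w' → embed (w ∧ w') ≈³ embed w ⊓ embed w'
  embed-∧ w w' = [x∧y]∧z≈[x∧z]∧[y∧z] w w' b , ∨-distribʳ-∧ b₂ w w' , ∨-distribʳ-∧ b₁ w w'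

  -- The hard inclusion is w ≤ w' ∨ S, which is checked below b and above b₁ and b₂.
  embed-diffᶻ : ∀ w w' → (w - w') ∧ b ≈
    ((w ∧ b) - (w' ∧ b)) ∨ ((((w ∨ b₂) - (w' ∨ b₂)) ∧ b) ∨ (((w ∨ b₁) - (w' ∨ b₁)) ∧ b))
  embed-diffᶻ w w' = ≤-antisym ≤-part ≥-part
    where
    A B₂ B₁ S : Carrier
    A  = (w ∧ b) - (w' ∧ b)
    B₂ = (w ∨ b₂) - (w' ∨ b₂)
    B₁ = (w ∨ b₁) - (w' ∨ b₁)
    S  = A ∨ (B₂ ∨ B₁)
    ≥-part : A ∨ ((B₂ ∧ b) ∨ (B₁ ∧ b)) ≤ (w - w') ∧ b
    ≥-part = ∨-least
      (∧-greatest ([x∧z]-[y∧z]≤x-y w w' b) (≤-trans (x-y≤x _ _) (x∧y≤y _ _)))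
      (∨-least (∧-mono ([x∨z]-[y∨z]≤x-y w w' b₂) ≤-refl) (∧-mono ([x∨z]-[y∨z]≤x-y w w' b₁) ≤-refl))
    ∨bᵢ-bound : ∀ bᵢ → ((w ∨ bᵢ) - (w' ∨ bᵢ)) ≤ S → w ∨ bᵢ ≤ (w' ∨ S) ∨ bᵢ
    ∨bᵢ-bound bᵢ Bᵢ≤S = begin
      w ∨ bᵢ                              ≤⟨ -‿upper (w ∨ bᵢ) (w' ∨ bᵢ) ⟩
      (w' ∨ bᵢ) ∨ ((w ∨ bᵢ) - (w' ∨ bᵢ))  ≤⟨ ∨-least (∨-mono (x≤x∨y w' S) ≤-refl)
                                               (≤-trans Bᵢ≤S (≤-trans (y≤x∨y w' S) (x≤x∨y _ _))) ⟩
      (w' ∨ S) ∨ bᵢ                       ∎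
    w≤w'∨S : w ≤ w' ∨ S
    w≤w'∨S = x∧z≤y⇒x∨z≤y∨z⇒x≤y b
      (≤-trans (-‿upper (w ∧ b) (w' ∧ b))
        (∨-mono (x∧y≤x w' b) (x≤x∨y A (B₂ ∨ B₁))))
      (∨b-mono (∨bᵢ-bound b₁ (≤-trans (y≤x∨y B₂ B₁) (y≤x∨y A _)))
               (∨bᵢ-bound b₂ (≤-trans (x≤x∨y B₂ B₁) (y≤x∨y A _))))
    ≤-part : (w - w') ∧ b ≤ A ∨ ((B₂ ∧ b) ∨ (B₁ ∧ b))
    ≤-part = begin
      (w - w') ∧ b                      ≤⟨ ∧-mono (≤∨⇒-≤ w≤w'∨S) ≤-refl ⟩
      S ∧ b                             ≈⟨ ∧-distribʳ-∨ b A (B₂ ∨ B₁) ⟩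
      (A ∧ b) ∨ ((B₂ ∨ B₁) ∧ b)         ≈⟨ ∨-congˡ (∧-distribʳ-∨ b B₂ B₁) ⟩
      (A ∧ b) ∨ ((B₂ ∧ b) ∨ (B₁ ∧ b))   ≤⟨ ∨-mono (x∧y≤x _ _) ≤-refl ⟩
      A ∨ ((B₂ ∧ b) ∨ (B₁ ∧ b))         ∎

  embed-diff : ∀ w w' → embed (w - w') ≈³ diff (embed w) (embed w')
  embed-diff w w' = embed-diffᶻ w w' , [x-y]∨z≈[[x∨z]-[y∨z]]∨z w w' b₂ , [x-y]∨z≈[[x∨z]-[y∨z]]∨z w w' b₁

  embedding : Embedding L glued
  embedding = record
    { ⟦_⟧ = embed
    ; cong = λ p → normalise-cong (∧-congʳ p , ∨-congʳ p , ∨-congʳ p)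
    ; injective = λ {w} {w'} p →
        let e≈e' = ≈³-sym (normalise-embed w) ⟫ p ⟫ normalise-embed w'
        in ≤-antisym (embed-reflects-≤ (≤³-reflexive e≈e')) (embed-reflects-≤ (≤³-reflexive (≈³-sym e≈e')))
    ; pres-𝟎 = ≈³⇒≈ᴳ (embed-admissible 𝟎) 𝟎ᴳ-admissible
        (≤𝟎⇒≈𝟎 (x∧y≤x _ _) , ≈-trans (∨-comm _ _) (∨-identityʳ _) , ≈-trans (∨-comm _ _) (∨-identityʳ _))
    ; pres-𝟏 = ≈³⇒≈ᴳ (embed-admissible 𝟏) 𝟏ᴳ-admissible
        (≈-trans (∧-comm _ _) (∧-identityʳ _) , ≤-antisym (≤𝟏 _) (x≤x∨y _ _) , ≤-antisym (≤𝟏 _) (x≤x∨y _ _))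
    ; pres-∨ = λ w w' → normalise-embed (w ∨ w') ⟫ embed-∨ w w' ⟫
        ≈³-sym (normalise-∨ᴳ _ _ ⟫ ⊔-cong (normalise-embed w) (normalise-embed w'))
    ; pres-∧ = λ w w' → normalise-embed (w ∧ w') ⟫ embed-∧ w w' ⟫
        ≈³-sym (normalise-∧ᴳ _ _ ⟫ ⊓-cong (normalise-embed w) (normalise-embed w'))
    ; pres-- = λ w w' → normalise-embed (w - w') ⟫ embed-diff w w' ⟫
        ≈³-sym (normalise-diff _ _ ⟫ diff-cong (normalise-embed w) (normalise-embed w'))
    }

  glued-finite : Finite L → Finite glued
  glued-finite (n , f , f-onto) = n * (n * n) , triple , triple-onto
    where
    triple-at : Fin n × Fin (n * n) → Triple
    triple-at (i , jl) = ⟨ f i , f (proj₁ (remQuot {n} n jl)) , f (proj₂ (remQuot {n} n jl)) ⟩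
    triple : Fin (n * (n * n)) → Triple
    triple k = triple-at (remQuot {n} (n * n) k)
    triple-combine : ∀ i j l → triple (combine i (combine j l)) ≡ ⟨ f i , f j , f l ⟩
    triple-combine i j l = trans (cong triple-at (remQuot-combine {n} {n * n} i (combine j l)))
      (cong (λ jl → ⟨ f i , f (proj₁ jl) , f (proj₂ jl) ⟩) (remQuot-combine {n} {n} j l))
    triple-onto : ∀ t → ∃ λ k → triple k ≈ᴳ t
    triple-onto ⟨ z₀ , x₀ , y₀ ⟩ with f-onto z₀ | f-onto x₀ | f-onto y₀
    ... | i , p | j , q | l , r = combine i (combine j l) ,
      subst (_≈ᴳ ⟨ z₀ , x₀ , y₀ ⟩) (sym (triple-combine i j l)) (normalise-cong (p , q , r))

module Split {c ℓ} (L : CoHeytingAlgebra c ℓ) (a b₁ b₂ : CoHeytingAlgebra.Carrier L)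
  (b₁∨b₂≪a : CoHeytingAlgebra._≪_ L (CoHeytingAlgebra._∨_ L b₁ b₂) a) where
  open Embed L b₁ b₂ public

  a-[b₁∨b₂]≈a : a - (b₁ ∨ b₂) ≈ a
  a-[b₁∨b₂]≈a = proj₁ b₁∨b₂≪a

  b₁≤a : b₁ ≤ a
  b₁≤a = ≤-trans (x≤x∨y b₁ b₂) (proj₂ b₁∨b₂≪a)

  b₂≤a : b₂ ≤ a
  b₂≤a = ≤-trans (y≤x∨y b₁ b₂) (proj₂ b₁∨b₂≪a)

  b≤a : b ≤ a
  b≤a = ≤-trans (x∧y≤x b₁ b₂) b₁≤a

  a≤b₁∨b₂⇒a≈𝟎 : a ≤ b₁ ∨ b₂ → a ≈ 𝟎
  a≤b₁∨b₂⇒a≈𝟎 a≤b₁∨b₂ = ≤𝟎⇒≈𝟎 (≤-trans (≤-reflexive (≈-sym a-[b₁∨b₂]≈a)) (x≤y⇒x-y≤𝟎 a≤b₁∨b₂))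

  a≤[a∨bᵢ]-bᵢ : ∀ {bᵢ} → bᵢ ≤ b₁ ∨ b₂ → a ≤ (a ∨ bᵢ) - bᵢ
  a≤[a∨bᵢ]-bᵢ bᵢ≤b₁∨b₂ = ≤-trans (≤-reflexive (≈-sym a-[b₁∨b₂]≈a)) (-‿mono (x≤x∨y a _) bᵢ≤b₁∨b₂)

  [[a∨bᵢ]-bᵢ]∨bᵢ≈a : ∀ {bᵢ} → bᵢ ≤ b₁ ∨ b₂ → ((a ∨ bᵢ) - bᵢ) ∨ bᵢ ≈ a
  [[a∨bᵢ]-bᵢ]∨bᵢ≈a {bᵢ} bᵢ≤b₁∨b₂ = ≤-antisym
    (∨-least (≤-trans (x-y≤x _ _) (∨-least ≤-refl bᵢ≤a)) bᵢ≤a)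
    (≤-trans (a≤[a∨bᵢ]-bᵢ bᵢ≤b₁∨b₂) (x≤x∨y _ _))
    where
    bᵢ≤a : bᵢ ≤ a
    bᵢ≤a = ≤-trans bᵢ≤b₁∨b₂ (proj₂ b₁∨b₂≪a)

  [[a∨bⱼ]-a]∨bⱼ≈bⱼ : ∀ bⱼ → ((a ∨ bⱼ) - a) ∨ bⱼ ≈ bⱼ
  [[a∨bⱼ]-a]∨bⱼ≈bⱼ bⱼ = ≤-antisym (∨-least (≤∨⇒-≤ ≤-refl) ≤-refl) (y≤x∨y _ _)

  a₁ a₂ : Triple
  a₁ = ⟨ b , a , b₁ ⟩
  a₂ = ⟨ b , b₂ , a ⟩

  a₁-admissible : Admissible a₁
  a₁-admissible = record
    { z≤b = ≤-refl ; b₂≤x = b₂≤a ; b₁≤y = ≤-refl ; [x-b₂]∧b≤z = x∧y≤y _ _ ; [y-b₁]∧b≤z = x∧y≤y _ _ }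

  a₂-admissible : Admissible a₂
  a₂-admissible = record
    { z≤b = ≤-refl ; b₂≤x = ≤-refl ; b₁≤y = b₁≤a ; [x-b₂]∧b≤z = x∧y≤y _ _ ; [y-b₁]∧b≤z = x∧y≤y _ _ }

  diff-embed-a-a₂ : diff (embed a) a₂ ≈³ a₁
  diff-embed-a-a₂ =
    ≤-antisym (z≤b (diff-admissible (embed-admissible a)))
      (≤-trans (∧-greatest (≤-trans b≤a (a≤[a∨bᵢ]-bᵢ (y≤x∨y b₁ b₂))) ≤-refl)
               (≤-trans (x≤x∨y _ _) (y≤x∨y _ _))) ,
    [[a∨bᵢ]-bᵢ]∨bᵢ≈a (y≤x∨y b₁ b₂) ,
    [[a∨bⱼ]-a]∨bⱼ≈bⱼ b₁

  diff-embed-a-a₁ : diff (embed a) a₁ ≈³ a₂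
  diff-embed-a-a₁ =
    ≤-antisym (z≤b (diff-admissible (embed-admissible a)))
      (≤-trans (∧-greatest (≤-trans b≤a (a≤[a∨bᵢ]-bᵢ (x≤x∨y b₁ b₂))) ≤-refl)
               (≤-trans (y≤x∨y _ _) (y≤x∨y _ _))) ,
    [[a∨bⱼ]-a]∨bⱼ≈bⱼ b₂ ,
    [[a∨bᵢ]-bᵢ]∨bᵢ≈a (x≤x∨y b₁ b₂)

  a₁≉𝟎 : ¬ (a ≈ 𝟎) → ¬ (a₁ ≈ᴳ 𝟎ᴳ)
  a₁≉𝟎 a≉𝟎 a₁≈𝟎 = a≉𝟎 (a≤b₁∨b₂⇒a≈𝟎 (≤-trans (≤-reflexive a≈b₂) (y≤x∨y b₁ b₂)))
    where
    a≈b₂ : a ≈ b₂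
    a≈b₂ = proj₁ (proj₂ (≈ᴳ⇒≈³ a₁-admissible 𝟎ᴳ-admissible a₁≈𝟎))

  a₂≉𝟎 : ¬ (a ≈ 𝟎) → ¬ (a₂ ≈ᴳ 𝟎ᴳ)
  a₂≉𝟎 a≉𝟎 a₂≈𝟎 = a≉𝟎 (a≤b₁∨b₂⇒a≈𝟎 (≤-trans (≤-reflexive a≈b₁) (x≤x∨y b₁ b₂)))
    where
    a≈b₁ : a ≈ b₁
    a≈b₁ = proj₂ (proj₂ (≈ᴳ⇒≈³ a₂-admissible 𝟎ᴳ-admissible a₂≈𝟎))

  embed-a-ᴳa₂≈a₁ : embed a -ᴳ a₂ ≈ᴳ a₁
  embed-a-ᴳa₂≈a₁ = normalise-diff _ _ ⟫
    diff-cong (normalise-embed a) (admissible⇒normalise≈ a₂-admissible) ⟫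
    diff-embed-a-a₂ ⟫ ≈³-sym (admissible⇒normalise≈ a₁-admissible)

  embed-a-ᴳa₁≈a₂ : embed a -ᴳ a₁ ≈ᴳ a₂
  embed-a-ᴳa₁≈a₂ = normalise-diff _ _ ⟫
    diff-cong (normalise-embed a) (admissible⇒normalise≈ a₁-admissible) ⟫
    diff-embed-a-a₁ ⟫ ≈³-sym (admissible⇒normalise≈ a₂-admissible)

  embed-b₁≤ᴳa₁ : embed b₁ ∧ᴳ a₁ ≈ᴳ embed b₁
  embed-b₁≤ᴳa₁ = admissible-≤³⇒≤ᴳ (embed-admissible b₁) a₁-admissible
    (x∧y≤y _ _ , ∨-least b₁≤a b₂≤a , ∨-least ≤-refl ≤-refl)

  embed-b₂≤ᴳa₂ : embed b₂ ∧ᴳ a₂ ≈ᴳ embed b₂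
  embed-b₂≤ᴳa₂ = admissible-≤³⇒≤ᴳ (embed-admissible b₂) a₂-admissible
    (x∧y≤y _ _ , ∨-least ≤-refl ≤-refl , ∨-least b₂≤a b₁≤a)

  a₁∧ᴳa₂≈embed-b : a₁ ∧ᴳ a₂ ≈ᴳ embed b
  a₁∧ᴳa₂≈embed-b = normalise-∧ᴳ a₁ a₂ ⟫
    ⊓-cong (admissible⇒normalise≈ a₁-admissible) (admissible⇒normalise≈ a₂-admissible) ⟫
    (≈-refl ,
     ≈-trans (≈-trans (∧-comm a b₂) b₂≤a) (≈-sym (≈-trans (∨-comm b b₂) (y≤x⇒x∨y≈x (x∧y≤y b₁ b₂)))) ,
     ≈-trans b₁≤a (≈-sym (≈-trans (∨-comm b b₁) (y≤x⇒x∨y≈x (x∧y≤x b₁ b₂))))) ⟫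
    ≈³-sym (normalise-embed b)

lemma4p2 : ∀ {c ℓ} (L : CoHeytingAlgebra c ℓ) → Finite L →
    ∀ (a b₁ b₂ : CoHeytingAlgebra.Carrier L) →
    CoHeytingAlgebra._≪_ L (CoHeytingAlgebra._∨_ L b₁ b₂) a →
    ¬ (CoHeytingAlgebra._≈_ L a (CoHeytingAlgebra.𝟎 L)) →
    Σ (CoHeytingAlgebra c ℓ) λ L' → Finite L' × Σ (Embedding L L') λ e →
      let open CoHeytingAlgebra L' in
      ∃ λ a₁ → ∃ λ a₂ →
        ¬ (a₁ ≈ 𝟎) × ¬ (a₂ ≈ 𝟎) ×
        ((Embedding.⟦_⟧ e a - a₂) ≈ a₁) × (Embedding.⟦_⟧ e b₁ ≤ a₁) ×
        ((Embedding.⟦_⟧ e a - a₁) ≈ a₂) × (Embedding.⟦_⟧ e b₂ ≤ a₂) ×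
        ((a₁ ∧ a₂) ≈ Embedding.⟦_⟧ e (CoHeytingAlgebra._∧_ L b₁ b₂))
lemma4p2 L L-finite a b₁ b₂ b₁∨b₂≪a a≉𝟎 =
  glued , glued-finite L-finite , embedding ,
  a₁ , a₂ , a₁≉𝟎 a≉𝟎 , a₂≉𝟎 a≉𝟎 ,
  embed-a-ᴳa₂≈a₁ , embed-b₁≤ᴳa₁ , embed-a-ᴳa₁≈a₂ , embed-b₂≤ᴳa₂ , a₁∧ᴳa₂≈embed-b
  where open Split L a b₁ b₂ b₁∨b₂≪a
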